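{- Let $G=(V,E)$ be a finite directed graph without loops whose edge set is partitioned as $E=E_1\cup\cdots\cup E_p$ into pairwise disjoint classes (the class $E_i$ consisting of the edges aligned with the spatial direction $\hat d_i$). Fix $i$, let $\bar E_i\subseteq E_i$ be non-empty, and let $G_C=(V_C,E_C)$ be the component connectivity graph (CCG) of $G$ implied by the removal of $\bar E_i$, and suppose $G_C$ has $k\ge 2$ vertices. Then the removal of $\bar E_i$ implies a $k$–PFD of $G$ if and only if $G_C$ is a directed acyclic graph.
   Context: Component connectivity graph: for a vertex set $W\subseteq V$ such that the induced subgraph $G[W]$ is weakly connected, and a set $F\subseteq E_i$, the CCG of $G[W]$ implied by the removal of $F$ is the simple directed graph whose vertices are the weakly connected components of the graph $G[W]$ with the edges of $F$ deleted, and in which there is an edge $(C,C')$ if and only if $C\neq C'$ and there is an edge $(v,u)\in F$ with $v\in C$, $u\in C'$. (Components are identified with their vertex sets.) 2–PFD: the removal of $F$ from $G[W]$ implies a 2–PFD of $G[W]$ into $C_1,C_2$ if its CCG has exactly two vertices $C_1,C_2$ and contains exactly one of the edges $(C_1,C_2)$, $(C_2,C_1)$. (This is the paper's combinatorial characterization of a physically feasible separation of a rigid model into two parts by pulling them apart along $\pm\hat d_i$.) $k$–PFD (recursive, for $k\ge 2$): let $W$ be such that $G[W]$ is weakly connected, let $F\subseteq E_i$ be non-empty with edges in $G[W]$, and suppose the CCG $(V_F,E_F)$ of $G[W]$ implied by removing $F$ has $k\ge 2$ vertices. The removal of $F$ implies a $k$–PFD of $G[W]$ if there is a set $F^0\subseteq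 F$ whose removal implies a 2–PFD of $G[W]$ into $C_1,C_2$ such that one of the following holds: (1) $C_1\in V_F$ and $C_2\in V_F$; (2) $C_1\in V_F$ and the removal of the edges of $F\setminus F^0$ lying in $G[C_2]$ implies a $(k-1)$–PFD of $G[C_2]$; (3) $C_2\in V_F$ and the removal of the edges of $F\setminus F^0$ lying in $G[C_1]$ implies a $(k-1)$–PFD of $G[C_1]$; (4) $C_1\notin V_F$, $C_2\notin V_F$, and the removal of the edges of $F\setminus F^0$ lying in $G[C_1]$, resp. $G[C_2]$, implies a $k_1$–PFD of $G[C_1]$, resp. a $k_2$–PFD of $G[C_2]$, with $k_1+k_2=k$. The statement applies this with $W=V$ (the graph $G$ of a model is weakly connected) and $F=\bar E_i$. -}

module Defs where

open import Data.Nat using (ℕ; _+_; _∸_; _≤_)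
open import Data.Fin using (Fin)
open import Data.Fin.Subset using (Subset; _∈_; _∉_; _⊆_; _∩_; _─_; Nonempty; ⊥)
open import Data.Bool using (_∧_)
open import Data.Vec using (tabulate; lookup)
open import Data.Product using (Σ; ∃; _×_; _,_)
open import Data.Sum using (_⊎_)
open import Relation.Nullary using (¬_)
open import Relation.Binary.PropositionalEquality using (_≡_; _≢_)
open import Relation.Binary.Construct.Closure.ReflexiveTransitive using (Star)
open import Relation.Binary.Construct.Closure.Transitive using (TransClosure)
open import Function.Definitions using (Injective)

-- A finite loopless directed graph G = (V , E) with V = Fin n and E = Fin m
-- (edge e goes from src e to tgt e), whose edges are partitioned into p
-- classes E_1 , … , E_p via the labelling cls (E_j = { e | cls e ≡ j }).
-- E is a set of ordered pairs: distinct edges have distinct endpoint pairs.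
record Graph : Set where
  field
    n m p  : ℕ
    src    : Fin m → Fin n
    tgt    : Fin m → Fin n
    cls    : Fin m → Fin p
    noLoop : ∀ e → src e ≢ tgt e
    simple : ∀ e e′ → src e ≡ src e′ → tgt e ≡ tgt e′ → e ≡ e′

module _ (G : Graph) where
  open Graph G

  InClass : Fin p → Subset m → Set
  InClass i F = ∀ e → e ∈ F → cls e ≡ i

  EdgeIn : Subset n → Fin m → Set
  EdgeIn W e = src e ∈ W × tgt e ∈ W

  restrict : Subset m → Subset n → Subset m
  restrict F W = tabulate λ e → lookup F e ∧ lookup W (src e) ∧ lookup W (tgt e)

  Adj : Subset n → Subset m → Fin n → Fin n → Set
  Adj W F u v = ∃ λ e → EdgeIn W e × e ∉ F ×
                  ((src e ≡ u × tgt e ≡ v) ⊎ (src e ≡ v × tgt e ≡ u))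

  Conn : Subset n → Subset m → Fin n → Fin n → Set
  Conn W F = Star (Adj W F)

  WeaklyConnected : Subset n → Set
  WeaklyConnected W = Nonempty W × (∀ u v → u ∈ W → v ∈ W → Conn W ⊥ u v)

  IsComponent : Subset n → Subset m → Subset n → Set
  IsComponent W F C = Σ (Fin n) λ u → u ∈ C ×
                        (∀ v → (v ∈ C → v ∈ W × Conn W F u v) × (v ∈ W → Conn W F u v → v ∈ C))

  CCGEdge : Subset n → Subset m → Subset n → Subset n → Set
  CCGEdge W F C C′ = IsComponent W F C × IsComponent W F C′ × C ≢ C′ ×
                     ∃ λ e → e ∈ F × src e ∈ C × tgt e ∈ C′

  NumComponents : Subset n → Subset m → ℕ → Set
  NumComponents W F k = Σ (Fin k → Subset n) λ f →
    (∀ j → IsComponent W F (f j)) × Injective _≡_ _≡_ f ×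
    (∀ C → IsComponent W F C → ∃ λ j → f j ≡ C)

  CCGAcyclic : Subset n → Subset m → Set
  CCGAcyclic W F = ∀ C → ¬ TransClosure (CCGEdge W F) C C

  TwoPFD : Subset n → Subset m → Subset n → Subset n → Set
  TwoPFD W F C₁ C₂ =
    IsComponent W F C₁ × IsComponent W F C₂ × C₁ ≢ C₂ ×
    (∀ C → IsComponent W F C → C ≡ C₁ ⊎ C ≡ C₂) ×
    ((CCGEdge W F C₁ C₂ × ¬ CCGEdge W F C₂ C₁) ⊎ (CCGEdge W F C₂ C₁ × ¬ CCGEdge W F C₁ C₂))

  data PFD (i : Fin p) : Subset n → Subset m → ℕ → Set where
    pfd : ∀ {W F k} →
          WeaklyConnected W → InClass i F → Nonempty F → (∀ e → e ∈ F → EdgeIn W e) →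
          2 ≤ k → NumComponents W F k →
          (F⁰ : Subset m) → F⁰ ⊆ F → (C₁ C₂ : Subset n) → TwoPFD W F⁰ C₁ C₂ →
          ((IsComponent W F C₁ × IsComponent W F C₂)
          ⊎ (IsComponent W F C₁ × PFD i C₂ (restrict (F ─ F⁰) C₂) (k ∸ 1))
          ⊎ (IsComponent W F C₂ × PFD i C₁ (restrict (F ─ F⁰) C₁) (k ∸ 1))
          ⊎ (¬ IsComponent W F C₁ × ¬ IsComponent W F C₂ ×
             Σ ℕ λ k₁ → Σ ℕ λ k₂ → k₁ + k₂ ≡ k ×
               PFD i C₁ (restrict (F ─ F⁰) C₁) k₁ × PFD i C₂ (restrict (F ─ F⁰) C₂) k₂)) →
          PFD i W F k

module Submission where

-- "Only if" (pfd⇒acyclic), by induction on the PFD.  At the root the F⁰-edges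
-- between the parts C₁ , C₂ run one way only, so no CCG edge leads back and a
-- CCG cycle stays inside one part (Confinement).  There it is a cycle of the
-- part's own sub-problem, acyclic by induction, once the components inside the
-- part are known to be the sub-problem's components; this follows by counting,
-- as both sides have k components in total (Refinement, Summary).
--
-- "If" (acyclic⇒pfd), by induction on k.  The acyclic CCG has a source s; the
-- weak component T of another vertex in G ∖ s and the rest S form a 2–PFD, as
-- every edge between them is an Ē-edge from s into T (Split).  Each part is a
-- single component or, having fewer components, has a PFD by induction.

open import Defs
open import Data.Nat using (ℕ; _≤_)
open import Data.Fin using (Fin)
open import Data.Fin.Subset using (Subset; ⊤; Nonempty)
open import Function.Bundles using (_⇔_)

open import Data.Nat using (zero; suc; _+_; _∸_; _<_; z≤n; s≤s)
import Data.Nat.Properties as ℕP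
open import Data.Bool using (Bool; true; _∧_)
open import Data.Bool.Properties using (∧-conicalˡ; ∧-conicalʳ)
open import Data.Fin using (zero; suc; _≟_; toℕ; punchIn; punchOut)
open import Data.Fin.Properties
  using (any?; injective⇒≤; punchIn-punchOut; punchInᵢ≢i; pigeonhole; suc-injective; 0≢1+n)
open import Data.Fin.Subset using (_∈_; _∉_; _⊆_; _∪_; _─_; ⊥; ⁅_⁆; ∣_∣)
open import Data.Fin.Subset.Properties
  using (_∈?_; ∈⊤; ∉⊥; x∈⁅x⁆; x∈⁅y⁆⇒x≡y; p⊆p∪q; q⊆p∪q; x∈p∪q⁻; ⊆-antisym;
         _⊂?_; p⊂q⇒∣p∣<∣q∣; ∣p∣≤n; ∣p∣≡n⇒p≡⊤; x∈p∧x∉q⇒x∈p─q; p─q⊆p; nonempty?;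
         ⊥⊆; ⊆-refl)
open import Data.Vec using (_∷_; there; tabulate; lookup)
open import Data.Vec.Properties using (lookup∘tabulate; []=⇒lookup; lookup⇒[]=)
open import Data.Product using (Σ; ∃; _×_; _,_; proj₁; proj₂)
open import Data.Sum using (_⊎_; inj₁; inj₂; [_,_]′; swap)
open import Data.Empty using () renaming (⊥ to Empty; ⊥-elim to absurd)
open import Relation.Nullary using (¬_; Dec; yes; no; does; contradiction)
open import Relation.Nullary.Decidable using (dec-true; _×-dec_; _⊎-dec_; ¬?)
open import Relation.Binary.PropositionalEquality using (_≡_; _≢_; refl; sym; trans; cong; subst)
import Relation.Binary.Construct.Closure.ReflexiveTransitive as RT
open RT using (Star; ε; _◅_; _◅◅_)
open import Relation.Binary.Construct.Closure.Transitive using (TransClosure; [_]; _∷_)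
open import Function.Bundles using (mk⇔)
open import Function.Definitions using (Injective)

∈-tabulate⁺ : ∀ {k} {g : Fin k → Bool} {x} → g x ≡ true → x ∈ tabulate g
∈-tabulate⁺ {g = g} {x} gx = lookup⇒[]= x (tabulate g) (trans (lookup∘tabulate g x) gx)

∈-tabulate⁻ : ∀ {k} {g : Fin k → Bool} {x} → x ∈ tabulate g → g x ≡ true
∈-tabulate⁻ {g = g} {x} x∈ = trans (sym (lookup∘tabulate g x)) ([]=⇒lookup x∈)

⟦_⟧ : ∀ {k} {P : Fin k → Set} → (∀ x → Dec (P x)) → Subset k
⟦ P? ⟧ = tabulate λ x → does (P? x)

∈⟦⟧⁺ : ∀ {k} {P : Fin k → Set} (P? : ∀ x → Dec (P x)) {x} → P x → x ∈ ⟦ P? ⟧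
∈⟦⟧⁺ P? {x} px = ∈-tabulate⁺ (dec-true (P? x) px)

∈⟦⟧⁻ : ∀ {k} {P : Fin k → Set} (P? : ∀ x → Dec (P x)) {x} → x ∈ ⟦ P? ⟧ → P x
∈⟦⟧⁻ P? {x} x∈ with P? x | ∈-tabulate⁻ {g = λ y → does (P? y)} x∈
... | yes px | _  = px
... | no _   | ()

x∈p─q⇒x∉q : ∀ {k} {x : Fin k} (p q : Subset k) → x ∈ p ─ q → x ∉ q
x∈p─q⇒x∉q (_ ∷ p) (_ ∷ q) (there x∈) (there x∈q) = x∈p─q⇒x∉q p q x∈ x∈q

Onto : ∀ {a b} → (Fin a → Fin b) → Set
Onto s = ∀ y → ∃ λ x → s x ≡ y

-- A surjection has an injective right inverse, so its target is no larger.
onto⇒≤ : ∀ {a b} (s : Fin a → Fin b) → Onto s → b ≤ a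
onto⇒≤ {a} {b} s onto = injective⇒≤ {f = section} section-injective
  where
  section : Fin b → Fin a
  section y = proj₁ (onto y)
  section-injective : Injective _≡_ _≡_ section
  section-injective {y} {y′} eq =
    trans (sym (proj₂ (onto y))) (trans (cong s eq) (proj₂ (onto y′)))

-- A surjective self-map of Fin a is injective: were s x ≡ s x′ with x ≢ x′,
-- then s without x would still be onto Fin (suc a) from Fin a.
onto⇒injective : ∀ {a} (s : Fin a → Fin a) → Onto s → Injective _≡_ _≡_ s
onto⇒injective {suc a} s onto {x} {x′} sx≡sx′ with x ≟ x′
... | yes x≡x′ = x≡x′
... | no x≢x′ = contradiction (onto⇒≤ (λ z → s (punchIn x z)) onto-without-x) ℕP.1+n≰n
  where
  onto-without-x : Onto (λ z → s (punchIn x z))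
  onto-without-x y with onto y
  ... | z , sz≡y with x ≟ z
  ...   | yes refl = punchOut x≢x′ , trans (cong s (punchIn-punchOut x≢x′)) (trans (sym sx≡sx′) sz≡y)
  ...   | no x≢z = punchOut x≢z , trans (cong s (punchIn-punchOut x≢z)) sz≡y

balanced-onto⇒injective : ∀ {a₁ a₂ b₁ b₂} → a₁ + a₂ ≡ b₁ + b₂ →
  (s₁ : Fin a₁ → Fin b₁) → Onto s₁ → (s₂ : Fin a₂ → Fin b₂) → Onto s₂ →
  Injective _≡_ _≡_ s₁ × Injective _≡_ _≡_ s₂
balanced-onto⇒injective {a₁} {a₂} {b₁} {b₂} sum s₁ onto₁ s₂ onto₂ =
  square (size-eq sum b₁≤a₁ b₂≤a₂) s₁ onto₁ ,
  square (size-eq (trans (ℕP.+-comm a₂ a₁) (trans sum (ℕP.+-comm b₁ b₂))) b₂≤a₂ b₁≤a₁)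
         s₂ onto₂
  where
  b₁≤a₁ = onto⇒≤ s₁ onto₁
  b₂≤a₂ = onto⇒≤ s₂ onto₂
  size-eq : ∀ {a a′ b b′} → a + a′ ≡ b + b′ → b ≤ a → b′ ≤ a′ → a ≡ b
  size-eq {a} {a′} {b} {b′} sum′ b≤a b′≤a′ = ℕP.≤-antisym
    (ℕP.+-cancelʳ-≤ a′ a b (subst (_≤ b + a′) (sym sum′) (ℕP.+-monoʳ-≤ b b′≤a′))) b≤a
  square : ∀ {a b} → a ≡ b → (s : Fin a → Fin b) → Onto s → Injective _≡_ _≡_ s
  square refl = onto⇒injective

Enumeration : ∀ {A : Set} → (A → Set) → ℕ → Set
Enumeration {A} P k =
  Σ (Fin k → A) λ f → (∀ j → P (f j)) × Injective _≡_ _≡_ f × (∀ x → P x → ∃ λ j → f j ≡ x)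

enumeration-cong : ∀ {A : Set} {P Q : A → Set} {k} →
  (∀ {x} → P x → Q x) → (∀ {x} → Q x → P x) → Enumeration P k → Enumeration Q k
enumeration-cong P⇒Q Q⇒P (f , all , inj , onto) =
  f , (λ j → P⇒Q (all j)) , inj , λ x qx → onto x (Q⇒P qx)

enumeration-sub : ∀ {A : Set} {P R : A → Set} {k a} →
  (e : Enumeration P k) → Enumeration (λ j → R (proj₁ e j)) a → Enumeration (λ x → P x × R x) a
enumeration-sub {P = P} {R} (f , all , inj , onto) (g , gR , ginj , gonto) =
  (λ y → f (g y)) , (λ y → all (g y) , gR y) , (λ eq → ginj (inj eq)) , onto′
  where
  onto′ : ∀ x → P x × R x → ∃ λ y → f (g y) ≡ x
  onto′ x (px , rx) with onto x px
  ... | j , fj≡x with gonto j (subst R (sym fj≡x) rx)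
  ...   | y , gy≡j = y , trans (cong f gy≡j) fj≡x

record Partition {k} (P : Fin k → Set) : Set where
  field
    size⁺ size⁻ : ℕ
    sizes       : size⁺ + size⁻ ≡ k
    enum⁺       : Enumeration P size⁺
    enum⁻       : Enumeration (λ j → ¬ P j) size⁻

private
  enumeration-empty : {P : Fin 0 → Set} → Enumeration P 0
  enumeration-empty = (λ ()) , (λ ()) , (λ {x} → λ {}) , λ ()

  enumeration-shift : ∀ {k a} {P : Fin (suc k) → Set} →
    ¬ P zero → Enumeration (λ j → P (suc j)) a → Enumeration P a
  enumeration-shift {P = P} ¬p₀ (g , all , inj , onto) =
    (λ y → suc (g y)) , all , (λ eq → inj (suc-injective eq)) , onto′
    where
    onto′ : ∀ j → P j → ∃ λ y → suc (g y) ≡ j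
    onto′ zero    p₀ = contradiction p₀ ¬p₀
    onto′ (suc j) pj = let y , gy≡j = onto j pj in y , cong suc gy≡j

  enumeration-cons : ∀ {k a} {P : Fin (suc k) → Set} →
    P zero → Enumeration (λ j → P (suc j)) a → Enumeration P (suc a)
  enumeration-cons {k} {a} {P} p₀ (g , all , inj , onto) = g′ , all′ , inj′ , onto′
    where
    g′ : Fin (suc a) → Fin (suc k)
    g′ zero    = zero
    g′ (suc y) = suc (g y)
    all′ : ∀ y → P (g′ y)
    all′ zero    = p₀
    all′ (suc y) = all y
    inj′ : Injective _≡_ _≡_ g′
    inj′ {zero}  {zero}  _  = refl
    inj′ {suc y} {suc z} eq = cong suc (inj (suc-injective eq))
    onto′ : ∀ j → P j → ∃ λ y → g′ y ≡ j
    onto′ zero    _  = zero , refl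
    onto′ (suc j) pj = let y , gy≡j = onto j pj in suc y , cong suc gy≡j

partition : ∀ {k} (P : Fin k → Set) → (∀ j → Dec (P j)) → Partition P
partition {zero}  P P? = record { size⁺ = 0 ; size⁻ = 0 ; sizes = refl
                                ; enum⁺ = enumeration-empty ; enum⁻ = enumeration-empty }
partition {suc k} P P? with partition (λ j → P (suc j)) (λ j → P? (suc j)) | P? zero
... | rest | yes p₀ = record { size⁺ = suc size⁺ ; size⁻ = size⁻ ; sizes = cong suc sizes
                             ; enum⁺ = enumeration-cons p₀ enum⁺
                             ; enum⁻ = enumeration-shift (λ ¬p₀ → ¬p₀ p₀) enum⁻ }
  where open Partition rest
... | rest | no ¬p₀ = record { size⁺ = size⁺ ; size⁻ = suc size⁻
                             ; sizes = trans (ℕP.+-suc size⁺ size⁻) (cong suc sizes)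
                             ; enum⁺ = enumeration-shift ¬p₀ enum⁺
                             ; enum⁻ = enumeration-cons ¬p₀ enum⁻ }
  where open Partition rest

-- In a finite acyclic relation R, a decidable property guaranteeing an
-- R-predecessor cannot hold everywhere: otherwise walking backwards k + 1
-- steps would revisit a vertex and so close a cycle.
module _ {k} (R : Fin k → Fin k → Set) (acyclic : ∀ j → ¬ TransClosure R j j)
         {HasPred : Fin k → Set} (HasPred? : ∀ j → Dec (HasPred j))
         (pred : ∀ {j} → HasPred j → ∃ λ j′ → R j′ j) where

  minimal : Fin k → ∃ λ j → ¬ HasPred j
  minimal j₀ with any? (λ j → ¬? (HasPred? j))
  ... | yes found = found
  ... | no none   = absurd (acyclic _ (proj₂ cycle))
    where
    everywhere : ∀ j → HasPred j
    everywhere j with HasPred? j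
    ... | yes h  = h
    ... | no ¬h = contradiction (j , ¬h) none

    walk : ℕ → Fin k
    walk zero    = j₀
    walk (suc N) = proj₁ (pred (everywhere (walk N)))

    step : ∀ N → R (walk (suc N)) (walk N)
    step N = proj₂ (pred (everywhere (walk N)))

    back : ∀ {a} b → a < b → TransClosure R (walk b) (walk a)
    back (suc b) (s≤s a≤b) with ℕP.m≤n⇒m<n∨m≡n a≤b
    ... | inj₂ refl = [ step b ]
    ... | inj₁ a<b  = step b ∷ back b a<b

    cycle : ∃ λ x → TransClosure R x x
    cycle with pigeonhole (ℕP.n<1+n k) (λ (i : Fin (suc k)) → walk (toℕ i))
    ... | i , j , i<j , same =
      walk (toℕ i) , subst (λ z → TransClosure R z (walk (toℕ i))) (sym same) (back (toℕ j) i<j)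

-- Each round either
-- adds a vertex or reaches a fixpoint, so after k rounds the set is closed
-- under A, which makes it complete.
module Reachability {k} (A : Fin k → Fin k → Set) (A? : ∀ u v → Dec (A u v)) where
  private
    successor? : ∀ R v → Dec (∃ λ w → w ∈ R × A w v)
    successor? R v = any? λ w → (w ∈? R) ×-dec A? w v

    successors : Subset k → Subset k
    successors R = ⟦ successor? R ⟧

    step : Subset k → Subset k
    step R = R ∪ successors R

    iterate : ℕ → Subset k → Subset k
    iterate zero    R = R
    iterate (suc j) R = iterate j (step R)

    Closed : Subset k → Set
    Closed R = ∀ {w v} → w ∈ R → A w v → v ∈ R

    step-⊇ : ∀ {R} → R ⊆ step R
    step-⊇ {R} = p⊆p∪q (successors R)

    step-successor : ∀ {R w v} → w ∈ R → A w v → v ∈ step R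
    step-successor {R} w∈R a = q⊆p∪q R (successors R) (∈⟦⟧⁺ (successor? R) (_ , w∈R , a))

    step⁻ : ∀ {R v} → v ∈ step R → v ∈ R ⊎ ∃ λ w → w ∈ R × A w v
    step⁻ {R} v∈ with x∈p∪q⁻ R (successors R) v∈
    ... | inj₁ v∈R = inj₁ v∈R
    ... | inj₂ v∈S = inj₂ (∈⟦⟧⁻ (successor? R) v∈S)

    iterate-⊇ : ∀ j {R} → R ⊆ iterate j R
    iterate-⊇ zero    x∈ = x∈
    iterate-⊇ (suc j) x∈ = iterate-⊇ j (step-⊇ x∈)

    iterate-fixpoint : ∀ j {R} → step R ≡ R → iterate j R ≡ R
    iterate-fixpoint zero    _     = refl
    iterate-fixpoint (suc j) fixed rewrite fixed = iterate-fixpoint j fixed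

    iterate-invariant : ∀ (P : Fin k → Set) → (∀ {w v} → P w → A w v → P v) →
                        ∀ j {R} → (∀ {v} → v ∈ R → P v) → ∀ {v} → v ∈ iterate j R → P v
    iterate-invariant P closed zero    inv = inv
    iterate-invariant P closed (suc j) {R} inv = iterate-invariant P closed j inv′
      where
      inv′ : ∀ {v} → v ∈ step R → P v
      inv′ v∈ with step⁻ v∈
      ... | inj₁ v∈R            = inv v∈R
      ... | inj₂ (w , w∈R , a) = closed (inv w∈R) a

    iterate-closed : ∀ j R → k ≤ j + ∣ R ∣ → Closed (iterate j R)
    iterate-closed zero R k≤∣R∣ {v = v} _ _ =
      subst (v ∈_) (sym (∣p∣≡n⇒p≡⊤ (ℕP.≤-antisym (∣p∣≤n R) k≤∣R∣))) ∈⊤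
    iterate-closed (suc j) R k≤ with R ⊂? step R
    ... | yes grows = iterate-closed j (step R)
          (ℕP.≤-trans k≤ (subst (_≤ j + ∣ step R ∣) (ℕP.+-suc j ∣ R ∣)
                                 (ℕP.+-monoʳ-≤ j (p⊂q⇒∣p∣<∣q∣ grows))))
    ... | no stuck = λ w∈ a →
      subst (_ ∈_) (sym settled) (saturated (step-successor (subst (_ ∈_) settled w∈) a))
      where
      saturated : step R ⊆ R
      saturated {x} x∈ with x ∈? R
      ... | yes x∈R = x∈R
      ... | no x∉R  = contradiction ((λ {y} → step-⊇ {R} {y}) , x , x∈ , x∉R) stuck
      settled : iterate j (step R) ≡ R
      settled = trans (cong (iterate j) fixed) (iterate-fixpoint j fixed)
        where fixed = ⊆-antisym saturated step-⊇

  opaque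
    reachable : Fin k → Subset k
    reachable u = iterate k ⁅ u ⁆

    reachable-sound : ∀ {u v} → v ∈ reachable u → Star A u v
    reachable-sound {u} = iterate-invariant (Star A u) (λ s a → s ◅◅ (a ◅ ε)) k
      (λ v∈ → subst (Star A u) (sym (x∈⁅y⁆⇒x≡y u v∈)) ε)

    reachable-complete : ∀ {u v} → Star A u v → v ∈ reachable u
    reachable-complete {u} = go (iterate-⊇ k (x∈⁅x⁆ u))
      where
      go : ∀ {w v} → w ∈ reachable u → Star A w v → v ∈ reachable u
      go w∈ ε       = w∈
      go w∈ (a ◅ s) = go (iterate-closed k ⁅ u ⁆ (ℕP.m≤m+n k _) w∈ a) s

map⁺ : ∀ {A B : Set} {R : A → A → Set} {S : B → B → Set} (f : A → B) →
       (∀ {x y} → R x y → S (f x) (f y)) → ∀ {x y} → TransClosure R x y → TransClosure S (f x) (f y)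
map⁺ f g [ r ]    = [ g r ]
map⁺ f g (r ∷ rs) = g r ∷ map⁺ f g rs

first-edge : ∀ {A : Set} {R : A → A → Set} {x y} → TransClosure R x y → ∃ λ z → R x z
first-edge [ r ]   = _ , r
first-edge (r ∷ _) = _ , r

last-edge : ∀ {A : Set} {R : A → A → Set} {x y} → TransClosure R x y → ∃ λ z → R z y
last-edge [ r ]    = _ , r
last-edge (_ ∷ rs) = last-edge rs

Restrict : ∀ {A : Set} → (A → A → Set) → (A → Set) → A → A → Set
Restrict R P x y = R x y × P x × P y

-- Confinement of cycles: if every R-edge ends in exactly one of P and Q and
-- P is closed under R, then an R-cycle lies entirely in P or entirely in Q
-- (having left Q for P, it could never come back).
module Confinement {A : Set} {R : A → A → Set} (P Q : A → Set)
                   (ends : ∀ {x y} → R x y → P y ⊎ Q y)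
                   (P-closed : ∀ {x y} → P x → R x y → P y)
                   (exclusive : ∀ {x y} → R x y → P y → Q y → Empty) where
  private
    stay-in-P : ∀ {x y} → P x → TransClosure R x y → TransClosure (Restrict R P) x y
    stay-in-P px [ r ]    = [ r , px , P-closed px r ]
    stay-in-P px (r ∷ rs) = (r , px , P-closed px r) ∷ stay-in-P (P-closed px r) rs

    ends-in-P : ∀ {x y} → P x → TransClosure R x y → P y
    ends-in-P px [ r ]    = P-closed px r
    ends-in-P px (r ∷ rs) = ends-in-P (P-closed px r) rs

    stay-in-Q : ∀ {x y} → Q x → Q y → TransClosure R x y → TransClosure (Restrict R Q) x y
    stay-in-Q qx qy [ r ] = [ r , qx , qy ]
    stay-in-Q qx qy (r ∷ rs) with ends r
    ... | inj₁ pz = absurd (exclusive (proj₂ (last-edge rs)) (ends-in-P pz rs) qy)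
    ... | inj₂ qz = (r , qx , qz) ∷ stay-in-Q qz qy rs

  confine : ∀ {x} → TransClosure R x x → TransClosure (Restrict R P) x x ⊎ TransClosure (Restrict R Q) x x
  confine cycle with ends (proj₂ (last-edge cycle))
  ... | inj₁ px = inj₁ (stay-in-P px cycle)
  ... | inj₂ qx = inj₂ (stay-in-Q qx qx cycle)


module Components (G : Graph) where
  open Graph G

  ∈-restrict⁻ : ∀ {F W e} → e ∈ restrict G F W → e ∈ F × EdgeIn G W e
  ∈-restrict⁻ {F} {W} {e} e∈ =
    lookup⇒[]= e F (∧-conicalˡ _ _ all) ,
    lookup⇒[]= (src e) W (∧-conicalˡ _ _ rest) , lookup⇒[]= (tgt e) W (∧-conicalʳ _ _ rest)
    where
    all : lookup F e ∧ lookup W (src e) ∧ lookup W (tgt e) ≡ true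
    all = ∈-tabulate⁻ {g = λ e → lookup F e ∧ lookup W (src e) ∧ lookup W (tgt e)} e∈
    rest : lookup W (src e) ∧ lookup W (tgt e) ≡ true
    rest = ∧-conicalʳ (lookup F e) _ all

  ∈-restrict⁺ : ∀ {F W e} → e ∈ F → EdgeIn G W e → e ∈ restrict G F W
  ∈-restrict⁺ e∈F (s∈W , t∈W) =
    ∈-tabulate⁺ (conj ([]=⇒lookup e∈F) (conj ([]=⇒lookup s∈W) ([]=⇒lookup t∈W)))
    where
    conj : ∀ {a b} → a ≡ true → b ≡ true → a ∧ b ≡ true
    conj refl refl = refl

  Adj? : ∀ W F u v → Dec (Adj G W F u v)
  Adj? W F u v = any? λ e → ((src e ∈? W) ×-dec (tgt e ∈? W)) ×-dec ¬? (e ∈? F) ×-dec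
                   (((src e ≟ u) ×-dec (tgt e ≟ v)) ⊎-dec ((src e ≟ v) ×-dec (tgt e ≟ u)))

  Adj-sym : ∀ {W F u v} → Adj G W F u v → Adj G W F v u
  Adj-sym (e , e∈W , e∉F , inj₁ ends) = e , e∈W , e∉F , inj₂ ends
  Adj-sym (e , e∈W , e∉F , inj₂ ends) = e , e∈W , e∉F , inj₁ ends

  Adj-target : ∀ {W F u v} → Adj G W F u v → v ∈ W
  Adj-target (e , (_ , t∈W) , _ , inj₁ (_ , refl)) = t∈W
  Adj-target (e , (s∈W , _) , _ , inj₂ (refl , _)) = s∈W

  edge-within : ∀ {X e u v} → u ∈ X → v ∈ X →
                (src e ≡ u × tgt e ≡ v) ⊎ (src e ≡ v × tgt e ≡ u) → EdgeIn G X e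
  edge-within u∈X v∈X (inj₁ (refl , refl)) = u∈X , v∈X
  edge-within u∈X v∈X (inj₂ (refl , refl)) = v∈X , u∈X

  Adj-within : ∀ {W F X F′ u v} → F′ ⊆ F → u ∈ X → v ∈ X → Adj G W F u v → Adj G X F′ u v
  Adj-within F′⊆F u∈X v∈X (e , _ , e∉F , ends) =
    e , edge-within u∈X v∈X ends , (λ e∈F′ → e∉F (F′⊆F e∈F′)) , ends

  Adj-mono : ∀ {W F F′ u v} → F′ ⊆ F → Adj G W F u v → Adj G W F′ u v
  Adj-mono F′⊆F (e , e∈W , e∉F , ends) = e , e∈W , (λ e∈F′ → e∉F (F′⊆F e∈F′)) , ends

  Conn-sym : ∀ {W F u v} → Conn G W F u v → Conn G W F v u
  Conn-sym = RT.reverse Adj-sym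

  Conn-mono : ∀ {W F F′ u v} → F′ ⊆ F → Conn G W F u v → Conn G W F′ u v
  Conn-mono F′⊆F = RT.map (Adj-mono F′⊆F)

  AdjClosed : Subset n → Subset m → Subset n → Set
  AdjClosed W F X = ∀ {a b} → a ∈ X → Adj G W F a b → b ∈ X

  Conn-closed : ∀ {W F X u v} → AdjClosed W F X → u ∈ X → Conn G W F u v → v ∈ X
  Conn-closed closed u∈X ε       = u∈X
  Conn-closed closed u∈X (a ◅ s) = Conn-closed closed (closed u∈X a) s

  AdjClosed-mono : ∀ {W F F⁰ X} → F⁰ ⊆ F → AdjClosed W F⁰ X → AdjClosed W F X
  AdjClosed-mono F⁰⊆F closed a∈X adj = closed a∈X (Adj-mono F⁰⊆F adj)

  Conn-stays : ∀ {W F u v} → u ∈ W → Conn G W F u v → v ∈ W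
  Conn-stays u∈W = Conn-closed (λ _ → Adj-target) u∈W

  Conn-restrict : ∀ {W F X F′ u v} → AdjClosed W F X → F′ ⊆ F →
                  u ∈ X → Conn G W F u v → Conn G X F′ u v
  Conn-restrict closed F′⊆F u∈X ε       = ε
  Conn-restrict closed F′⊆F u∈X (a ◅ s) =
    Adj-within F′⊆F u∈X (closed u∈X a) a ◅ Conn-restrict closed F′⊆F (closed u∈X a) s

  Conn-extend : ∀ {W F X F′ u v} → X ⊆ W → (∀ e → EdgeIn G X e → e ∈ F → e ∈ F′) →
                Conn G X F′ u v → Conn G W F u v
  Conn-extend X⊆W F-in-F′ = RT.map λ where
    (e , e∈X@(s∈X , t∈X) , e∉F′ , ends) →
      e , (X⊆W s∈X , X⊆W t∈X) , (λ e∈F → e∉F′ (F-in-F′ e e∈X e∈F)) , ends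

  component : Subset n → Subset m → Fin n → Subset n
  component W F u = Reachability.reachable (Adj G W F) (Adj? W F) u

  component-sound : ∀ {W F u v} → v ∈ component W F u → Conn G W F u v
  component-sound {W} {F} = Reachability.reachable-sound (Adj G W F) (Adj? W F)

  component-complete : ∀ {W F u v} → Conn G W F u v → v ∈ component W F u
  component-complete {W} {F} = Reachability.reachable-complete (Adj G W F) (Adj? W F)

  component-isComponent : ∀ {W F u} → u ∈ W → IsComponent G W F (component W F u)
  component-isComponent u∈W = _ , component-complete ε , λ v →
    (λ v∈ → Conn-stays u∈W (component-sound v∈) , component-sound v∈) , λ _ c → component-complete c

  anchor : ∀ {W F C} → IsComponent G W F C → Fin n
  anchor = proj₁

  anchor∈ : ∀ {W F C} (p : IsComponent G W F C) → anchor p ∈ C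
  anchor∈ p = proj₁ (proj₂ p)

  component⊆ : ∀ {W F C} → IsComponent G W F C → C ⊆ W
  component⊆ (_ , _ , spans) v∈ = proj₁ (proj₁ (spans _) v∈)

  component-connected : ∀ {W F C u v} → IsComponent G W F C → u ∈ C → v ∈ C → Conn G W F u v
  component-connected (_ , _ , spans) u∈ v∈ =
    Conn-sym (proj₂ (proj₁ (spans _) u∈)) ◅◅ proj₂ (proj₁ (spans _) v∈)

  component-closed : ∀ {W F C} → IsComponent G W F C → AdjClosed W F C
  component-closed p@(_ , _ , spans) a∈ adj =
    proj₂ (spans _) (Adj-target adj) (proj₂ (proj₁ (spans _) a∈) ◅◅ (adj ◅ ε))

  component-unique : ∀ {W F C D v} → IsComponent G W F C → IsComponent G W F D →
                     v ∈ C → v ∈ D → C ≡ D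
  component-unique pC pD v∈C v∈D =
    ⊆-antisym (λ x∈C → Conn-closed (component-closed pD) v∈D (component-connected pC v∈C x∈C))
              (λ x∈D → Conn-closed (component-closed pC) v∈C (component-connected pD v∈D x∈D))

  component-≡ : ∀ {W F u v} → u ∈ W → Conn G W F u v → component W F u ≡ component W F v
  component-≡ u∈W c = component-unique (component-isComponent u∈W)
    (component-isComponent (Conn-stays u∈W c)) (component-complete c) (component-complete ε)

  refines : ∀ {W F F⁰ X D v} → F⁰ ⊆ F → IsComponent G W F⁰ X → IsComponent G W F D →
            v ∈ D → v ∈ X → D ⊆ X
  refines F⁰⊆F pX pD v∈D v∈X x∈D =
    Conn-closed (component-closed pX) v∈X (Conn-mono F⁰⊆F (component-connected pD v∈D x∈D))

  closed-part-is-component : ∀ {W F X x} → X ⊆ W → AdjClosed W F X → x ∈ X →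
                             (∀ {v} → v ∈ X → Conn G W F x v) → IsComponent G W F X
  closed-part-is-component X⊆W closed x∈X reaches =
    _ , x∈X , λ v → (λ v∈X → X⊆W v∈X , reaches v∈X) , λ _ walk → Conn-closed closed x∈X walk

  module Part {W F X F′} (X⊆W : X ⊆ W) (closed : AdjClosed W F X) (F′⊆F : F′ ⊆ F)
              (F-in-F′ : ∀ e → EdgeIn G X e → e ∈ F → e ∈ F′) where

    component-to-part : ∀ {C} (pC : IsComponent G W F C) → anchor pC ∈ X → IsComponent G X F′ C
    component-to-part pC@(c , c∈C , spans) c∈X = c , c∈C , λ v →
      (λ v∈C → let walk = component-connected pC c∈C v∈C
               in Conn-closed closed c∈X walk , Conn-restrict closed F′⊆F c∈X walk) ,
      (λ v∈X walk → proj₂ (spans v) (X⊆W v∈X) (Conn-extend X⊆W F-in-F′ walk))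

    component-from-part : ∀ {C} → IsComponent G X F′ C → IsComponent G W F C
    component-from-part pC@(c , c∈C , spans) = c , c∈C , λ v →
      (λ v∈C → X⊆W (component⊆ pC v∈C) , Conn-extend X⊆W F-in-F′ (component-connected pC c∈C v∈C)) ,
      (λ v∈W walk → let c∈X = component⊆ pC c∈C
                    in proj₂ (spans v) (Conn-closed closed c∈X walk) (Conn-restrict closed F′⊆F c∈X walk))

module PFD⇒Acyclic (G : Graph) where
  open Graph G
  open Components G

  Within : Subset n → Subset m → Subset n → Subset n → Subset n → Set
  Within W F X = Restrict (CCGEdge G W F) (_⊆ X)

  -- inside a part that is itself a component there is no CCG edge at all
  within-component-acyclic : ∀ {W F X} → IsComponent G W F X → ∀ D → ¬ TransClosure (Within W F X) D D
  within-component-acyclic {W} {F} {X} pX D cycle = no-edge (proj₂ (first-edge cycle))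
    where
    is-X : ∀ {C} → IsComponent G W F C → C ⊆ X → C ≡ X
    is-X pC C⊆X = component-unique pC pX (anchor∈ pC) (C⊆X (anchor∈ pC))
    no-edge : ∀ {D D′} → Within W F X D D′ → Empty
    no-edge ((pD , pD′ , D≢D′ , _) , D⊆X , D′⊆X) =
      D≢D′ (trans (is-X pD D⊆X) (sym (is-X pD′ D′⊆X)))

  inner : Subset m → Subset m → Subset n → Subset m
  inner F F⁰ X = restrict G (F ─ F⁰) X

  inner⊆F : ∀ {F F⁰ X e} → e ∈ inner F F⁰ X → e ∈ F
  inner⊆F {F} {F⁰} {X} e∈ = p─q⊆p F F⁰ (proj₁ (∈-restrict⁻ {F ─ F⁰} {X} e∈))

  -- If the components of G[W] − F inside X are exactly components of the
  -- sub-problem G[X] − inner, then the CCG edges inside X are edges of the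
  -- sub-problem's CCG (an F⁰-edge cannot join two of them), so an acyclic
  -- sub-problem CCG leaves no cycle inside X.
  within-refined-acyclic : ∀ {W F F⁰ X} →
    (∀ {D} → IsComponent G W F D → D ⊆ X → IsComponent G X (inner F F⁰ X) D) →
    CCGAcyclic G X (inner F F⁰ X) → ∀ D → ¬ TransClosure (Within W F X) D D
  within-refined-acyclic {W} {F} {F⁰} {X} refined acyclic D cycle =
    acyclic D (map⁺ (λ D → D) inner-edge cycle)
    where
    inner-edge : ∀ {D D′} → Within W F X D D′ → CCGEdge G X (inner F F⁰ X) D D′
    inner-edge ((pD , pD′ , D≢D′ , e , e∈F , s∈D , t∈D′) , D⊆X , D′⊆X) =
      qD , qD′ , D≢D′ , e , e∈inner , s∈D , t∈D′
      where
      qD  = refined pD D⊆X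
      qD′ = refined pD′ D′⊆X
      e∈inner : e ∈ inner F F⁰ X
      e∈inner with e ∈? F⁰
      ... | no e∉F⁰ = ∈-restrict⁺ (x∈p∧x∉q⇒x∈p─q e∈F e∉F⁰) (D⊆X s∈D , D′⊆X t∈D′)
      ... | yes e∈F⁰ = contradiction (component-unique qD qD′ (component-closed qD s∈D adj) t∈D′) D≢D′
        where
        adj : Adj G X (inner F F⁰ X) (src e) (tgt e)
        adj = e , (D⊆X s∈D , D′⊆X t∈D′) ,
              (λ e∈ → x∈p─q⇒x∉q F F⁰ (proj₁ (∈-restrict⁻ {F ─ F⁰} {X} e∈)) e∈F⁰) ,
              inj₁ (refl , refl)

  module Node {W F F⁰ C₁ C₂} (F⁰⊆F : F⁰ ⊆ F) (two : TwoPFD G W F⁰ C₁ C₂) where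
    private
      pC₁ : IsComponent G W F⁰ C₁
      pC₁ = proj₁ two
      pC₂ : IsComponent G W F⁰ C₂
      pC₂ = proj₁ (proj₂ two)
      C₁≢C₂ : C₁ ≢ C₂
      C₁≢C₂ = proj₁ (proj₂ (proj₂ two))
      only-parts : ∀ C → IsComponent G W F⁰ C → C ≡ C₁ ⊎ C ≡ C₂
      only-parts = proj₁ (proj₂ (proj₂ (proj₂ two)))
      direction : (CCGEdge G W F⁰ C₁ C₂ × ¬ CCGEdge G W F⁰ C₂ C₁) ⊎
                  (CCGEdge G W F⁰ C₂ C₁ × ¬ CCGEdge G W F⁰ C₁ C₂)
      direction = proj₂ (proj₂ (proj₂ (proj₂ two)))

    part-of : ∀ {u} → u ∈ W → u ∈ C₁ ⊎ u ∈ C₂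
    part-of {u} u∈W with only-parts (component W F⁰ u) (component-isComponent u∈W)
    ... | inj₁ eq = inj₁ (subst (u ∈_) eq (component-complete ε))
    ... | inj₂ eq = inj₂ (subst (u ∈_) eq (component-complete ε))

    parts-disjoint : ∀ {u} → u ∈ C₁ → u ∈ C₂ → Empty
    parts-disjoint u∈C₁ u∈C₂ = C₁≢C₂ (component-unique pC₁ pC₂ u∈C₁ u∈C₂)

    -- With the parts ordered A before B (no F⁰-edge from B to A), no F-edge
    -- leads from B back to A either, so a CCG cycle stays in A or in B.
    module Oriented {A B} (pA : IsComponent G W F⁰ A) (pB : IsComponent G W F⁰ B) (A≢B : A ≢ B)
                    (no-back : ¬ CCGEdge G W F⁰ B A) (part : ∀ {u} → u ∈ W → u ∈ A ⊎ u ∈ B) where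
      private
        no-edge-back : ∀ e → e ∈ F → src e ∈ B → tgt e ∈ A → Empty
        no-edge-back e e∈F s∈B t∈A with e ∈? F⁰
        ... | yes e∈F⁰ = no-back (pB , pA , (λ B≡A → A≢B (sym B≡A)) , e , e∈F⁰ , s∈B , t∈A)
        ... | no e∉F⁰ = A≢B (component-unique pA pB t∈A (component-closed pB s∈B adj))
          where
          adj : Adj G W F⁰ (src e) (tgt e)
          adj = e , (component⊆ pB s∈B , component⊆ pA t∈A) , e∉F⁰ , inj₁ (refl , refl)

        side : ∀ {D} → IsComponent G W F D → D ⊆ B ⊎ D ⊆ A
        side pD with part (component⊆ pD (anchor∈ pD))
        ... | inj₁ u∈A = inj₂ (refines F⁰⊆F pA pD (anchor∈ pD) u∈A)
        ... | inj₂ u∈B = inj₁ (refines F⁰⊆F pB pD (anchor∈ pD) u∈B)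

        downstream : ∀ {D D′} → D ⊆ B → CCGEdge G W F D D′ → D′ ⊆ B
        downstream D⊆B (_ , pD′ , _ , e , e∈F , s∈D , t∈D′) with side pD′
        ... | inj₁ D′⊆B = D′⊆B
        ... | inj₂ D′⊆A = absurd (no-edge-back e e∈F (D⊆B s∈D) (D′⊆A t∈D′))

        exclusive : ∀ {D D′} → CCGEdge G W F D D′ → D′ ⊆ B → D′ ⊆ A → Empty
        exclusive (_ , pD′ , _) D′⊆B D′⊆A =
          A≢B (component-unique pA pB (D′⊆A (anchor∈ pD′)) (D′⊆B (anchor∈ pD′)))

      confine-cycle : ∀ {D} → TransClosure (CCGEdge G W F) D D →
                      TransClosure (Within W F B) D D ⊎ TransClosure (Within W F A) D D
      confine-cycle = Confinement.confine (_⊆ B) (_⊆ A) (λ edge → side (proj₁ (proj₂ edge)))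
                                          downstream exclusive

    acyclic-from-parts : (∀ D → ¬ TransClosure (Within W F C₁) D D) →
                         (∀ D → ¬ TransClosure (Within W F C₂) D D) → CCGAcyclic G W F
    acyclic-from-parts no-cycle₁ no-cycle₂ D cycle with direction
    ... | inj₁ (_ , no-back) =
      [ no-cycle₂ D , no-cycle₁ D ]′ (Oriented.confine-cycle pC₁ pC₂ C₁≢C₂ no-back part-of cycle)
    ... | inj₂ (_ , no-back) =
      [ no-cycle₁ D , no-cycle₂ D ]′
        (Oriented.confine-cycle pC₂ pC₁ (λ C₂≡C₁ → C₁≢C₂ (sym C₂≡C₁)) no-back
                                (λ u∈W → swap (part-of u∈W)) cycle)

    InPart : Subset n → Subset n → Set
    InPart X D = IsComponent G W F D × D ⊆ X

    record PartEnumerations (k : ℕ) : Set where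
      field
        size₁ size₂ : ℕ
        sizes       : size₁ + size₂ ≡ k
        enum₁       : Enumeration (InPart C₁) size₁
        enum₂       : Enumeration (InPart C₂) size₂

    part-enumerations : ∀ {k} → NumComponents G W F k → PartEnumerations k
    part-enumerations nc@(f , fC , _) = record
      { size₁ = size⁺ ; size₂ = size⁻ ; sizes = sizes
      ; enum₁ = enumeration-sub nc (enumeration-cong in-C₁ anchor-in-C₁ enum⁺)
      ; enum₂ = enumeration-sub nc (enumeration-cong in-C₂ anchor-not-in-C₁ enum⁻) }
      where
      open Partition (partition (λ j → anchor (fC j) ∈ C₁) (λ j → anchor (fC j) ∈? C₁))
      anchor-in-C₁ : ∀ {j} → f j ⊆ C₁ → anchor (fC j) ∈ C₁
      anchor-in-C₁ {j} fj⊆C₁ = fj⊆C₁ (anchor∈ (fC j))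
      in-C₁ : ∀ {j} → anchor (fC j) ∈ C₁ → f j ⊆ C₁
      in-C₁ {j} u∈C₁ = refines F⁰⊆F pC₁ (fC j) (anchor∈ (fC j)) u∈C₁
      anchor-not-in-C₁ : ∀ {j} → f j ⊆ C₂ → anchor (fC j) ∉ C₁
      anchor-not-in-C₁ {j} fj⊆C₂ u∈C₁ = parts-disjoint u∈C₁ (fj⊆C₂ (anchor∈ (fC j)))
      in-C₂ : ∀ {j} → anchor (fC j) ∉ C₁ → f j ⊆ C₂
      in-C₂ {j} u∉C₁ with part-of (component⊆ (fC j) (anchor∈ (fC j)))
      ... | inj₁ u∈C₁ = contradiction u∈C₁ u∉C₁
      ... | inj₂ u∈C₂ = refines F⁰⊆F pC₂ (fC j) (anchor∈ (fC j)) u∈C₂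

    -- Sending each
    -- component of G[W] − F inside X to the sub-problem component containing it
    -- is onto; if it is also injective, the two families of components agree.
    module Refinement {X} (pX : IsComponent G W F⁰ X) {a} (enum : Enumeration (InPart X) a)
                      {kX} (ncX : NumComponents G X (inner F F⁰ X) kX) where
      private
        FX : Subset m
        FX = inner F F⁰ X
        g : Fin a → Subset n
        g = proj₁ enum
        g-in : ∀ y → InPart X (g y)
        g-in = proj₁ (proj₂ enum)
        g-onto : ∀ D → InPart X D → ∃ λ y → g y ≡ D
        g-onto = proj₂ (proj₂ (proj₂ enum))
        h : Fin kX → Subset n
        h = proj₁ ncX
        h-components : ∀ t → IsComponent G X FX (h t)
        h-components = proj₁ (proj₂ ncX)
        h-injective : Injective _≡_ _≡_ h
        h-injective = proj₁ (proj₂ (proj₂ ncX))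
        h-onto : ∀ C → IsComponent G X FX C → ∃ λ t → h t ≡ C
        h-onto = proj₂ (proj₂ (proj₂ ncX))

        into-X : ∀ {u v} → u ∈ X → Conn G W F u v → Conn G X FX u v
        into-X = Conn-restrict (AdjClosed-mono F⁰⊆F (component-closed pX)) (inner⊆F {F} {F⁰} {X})

        vertex-index : ∀ {v} → v ∈ X → Fin kX
        vertex-index v∈X = proj₁ (h-onto _ (component-isComponent {F = FX} v∈X))

        vertex-index-component : ∀ {v} (v∈X : v ∈ X) → h (vertex-index v∈X) ≡ component X FX v
        vertex-index-component v∈X = proj₂ (h-onto _ (component-isComponent v∈X))

        vertex-index-≡ : ∀ {u v} (u∈X : u ∈ X) (v∈X : v ∈ X) → Conn G X FX u v →
                         vertex-index u∈X ≡ vertex-index v∈X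
        vertex-index-≡ u∈X v∈X walk = h-injective
          (trans (vertex-index-component u∈X)
                 (trans (component-≡ u∈X walk) (sym (vertex-index-component v∈X))))

        enumerated : ∀ {v} → v ∈ X → ∃ λ y → v ∈ g y
        enumerated {v} v∈X =
          let y , gy≡D = g-onto _ (pD , refines F⁰⊆F pX pD (component-complete ε) v∈X)
          in  y , subst (v ∈_) (sym gy≡D) (component-complete ε)
          where
          pD : IsComponent G W F (component W F v)
          pD = component-isComponent (component⊆ pX v∈X)

      index : Fin a → Fin kX
      index y = vertex-index (proj₂ (g-in y) (anchor∈ (proj₁ (g-in y))))

      private
        index-at : ∀ y {v} → v ∈ g y → (v∈X : v ∈ X) → index y ≡ vertex-index v∈X
        index-at y v∈gy v∈X = vertex-index-≡ _ v∈X
          (into-X (proj₂ (g-in y) (anchor∈ pgy)) (component-connected pgy (anchor∈ pgy) v∈gy))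
          where
          pgy : IsComponent G W F (g y)
          pgy = proj₁ (g-in y)

      index-onto : Onto index
      index-onto t = y , trans (index-at y c∈gy c∈X) (h-injective
        (trans (vertex-index-component c∈X)
               (component-unique (component-isComponent c∈X) (h-components t) (component-complete ε) c∈ht)))
        where
        c∈ht : anchor (h-components t) ∈ h t
        c∈ht = anchor∈ (h-components t)
        c∈X : anchor (h-components t) ∈ X
        c∈X = component⊆ (h-components t) c∈ht
        y : Fin a
        y = proj₁ (enumerated c∈X)
        c∈gy : anchor (h-components t) ∈ g y
        c∈gy = proj₂ (enumerated c∈X)

      injective⇒refined : Injective _≡_ _≡_ index →
                          ∀ {D} → IsComponent G W F D → D ⊆ X → IsComponent G X FX D
      injective⇒refined injective {D} pD D⊆X =
        subst (IsComponent G X FX) (sym D≡component) (component-isComponent u∈X)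
        where
        u∈X : anchor pD ∈ X
        u∈X = D⊆X (anchor∈ pD)
        y : Fin a
        y = proj₁ (g-onto D (pD , D⊆X))
        gy≡D : g y ≡ D
        gy≡D = proj₂ (g-onto D (pD , D⊆X))
        D≡component : D ≡ component X FX (anchor pD)
        D≡component = ⊆-antisym
          (λ v∈D → component-complete (into-X u∈X (component-connected pD (anchor∈ pD) v∈D)))
          λ {v} v∈ → let v∈X = component⊆ (component-isComponent u∈X) v∈
                         y′ = proj₁ (enumerated v∈X)
                         v∈gy′ = proj₂ (enumerated v∈X)
                         same = trans (index-at y′ v∈gy′ v∈X)
                                  (trans (vertex-index-≡ v∈X u∈X (Conn-sym (component-sound v∈)))
                                         (sym (index-at y (subst (_ ∈_) (sym gy≡D) (anchor∈ pD)) u∈X)))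
                     in subst (v ∈_) (trans (cong g (injective same)) gy≡D) v∈gy′

    data Summary (X : Subset n) : Set where
      whole : IsComponent G W F X → Summary X
      split : ∀ kX → NumComponents G X (inner F F⁰ X) kX → CCGAcyclic G X (inner F F⁰ X) → Summary X

    size : ∀ {X} → Summary X → ℕ
    size (whole _)       = 1
    size (split kX _ _)  = kX

    module Summarised {X} (pX : IsComponent G W F⁰ X) {a} (enum : Enumeration (InPart X) a) where
      index : (s : Summary X) → Fin a → Fin (size s)
      index (whole _)       _ = zero
      index (split _ ncX _)   = Refinement.index pX enum ncX

      index-onto : (s : Summary X) → Onto (index s)
      index-onto (whole pXF)     zero = proj₁ (proj₂ (proj₂ (proj₂ enum)) X (pXF , λ x∈ → x∈)) , refl
      index-onto (split _ ncX _)      = Refinement.index-onto pX enum ncX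

      acyclic : (s : Summary X) → Injective _≡_ _≡_ (index s) → ∀ D → ¬ TransClosure (Within W F X) D D
      acyclic (whole pXF)           _         = within-component-acyclic pXF
      acyclic (split _ ncX acyclicX) injective =
        within-refined-acyclic (Refinement.injective⇒refined pX enum ncX injective) acyclicX

    -- The counting step: if the part sizes add up to k, the index maps of both
    -- parts are bijective, so neither part contains a cycle.
    acyclic-from-summaries : ∀ {k} → NumComponents G W F k → (s₁ : Summary C₁) (s₂ : Summary C₂) →
                             size s₁ + size s₂ ≡ k → CCGAcyclic G W F
    acyclic-from-summaries nc s₁ s₂ sum =
      acyclic-from-parts (S₁.acyclic s₁ (proj₁ injective)) (S₂.acyclic s₂ (proj₂ injective))
      where
      open PartEnumerations (part-enumerations nc)
      module S₁ = Summarised pC₁ enum₁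
      module S₂ = Summarised pC₂ enum₂
      injective : Injective _≡_ _≡_ (S₁.index s₁) × Injective _≡_ _≡_ (S₂.index s₂)
      injective = balanced-onto⇒injective (trans sizes (sym sum))
                    (S₁.index s₁) (S₁.index-onto s₁) (S₂.index s₂) (S₂.index-onto s₂)

  numComponents : ∀ {i W F k} → PFD G i W F k → NumComponents G W F k
  numComponents (pfd _ _ _ _ _ nc _ _ _ _ _ _) = nc

  pfd⇒acyclic : ∀ {i W F k} → PFD G i W F k → CCGAcyclic G W F
  pfd⇒acyclic (pfd {k = k} _ _ _ _ 2≤k nc F⁰ F⁰⊆F C₁ C₂ two parts) with parts
  ... | inj₁ (p₁ , p₂) =
    acyclic-from-parts (within-component-acyclic p₁) (within-component-acyclic p₂)
    where open Node F⁰⊆F two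
  ... | inj₂ (inj₁ (p₁ , sub₂)) =
    acyclic-from-summaries nc (whole p₁) (split _ (numComponents sub₂) (pfd⇒acyclic sub₂))
      (ℕP.m+[n∸m]≡n (ℕP.≤-trans (s≤s z≤n) 2≤k))
    where open Node F⁰⊆F two
  ... | inj₂ (inj₂ (inj₁ (p₂ , sub₁))) =
    acyclic-from-summaries nc (split _ (numComponents sub₁) (pfd⇒acyclic sub₁)) (whole p₂)
      (trans (ℕP.+-comm (k ∸ 1) 1) (ℕP.m+[n∸m]≡n (ℕP.≤-trans (s≤s z≤n) 2≤k)))
    where open Node F⁰⊆F two
  ... | inj₂ (inj₂ (inj₂ (_ , _ , k₁ , k₂ , sum , sub₁ , sub₂))) =
    acyclic-from-summaries nc (split k₁ (numComponents sub₁) (pfd⇒acyclic sub₁))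
                              (split k₂ (numComponents sub₂) (pfd⇒acyclic sub₂)) sum
    where open Node F⁰⊆F two

module Acyclic⇒PFD (G : Graph) (i : Fin (Graph.p G)) where
  open Graph G
  open Components G
  open PFD⇒Acyclic G using (inner; inner⊆F)

  module SubProblem {W F F⁰ X} (F⁰⊆F : F⁰ ⊆ F) (X⊆W : X ⊆ W) (closed : AdjClosed W F⁰ X)
                    (no-F⁰ : ∀ e → EdgeIn G X e → e ∉ F⁰) where
    private
      FX : Subset m
      FX = inner F F⁰ X

      F-in-FX : ∀ e → EdgeIn G X e → e ∈ F → e ∈ FX
      F-in-FX e e∈X e∈F = ∈-restrict⁺ (x∈p∧x∉q⇒x∈p─q e∈F (no-F⁰ e e∈X)) e∈X

      closedF : AdjClosed W F X
      closedF = AdjClosed-mono F⁰⊆F closed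

      open Part X⊆W closedF (inner⊆F {F} {F⁰} {X}) F-in-FX

      anchor-in : ∀ {D v} (pD : IsComponent G W F D) → v ∈ D → v ∈ X → anchor pD ∈ X
      anchor-in pD v∈D v∈X = Conn-closed closedF v∈X (component-connected pD v∈D (anchor∈ pD))

    class : InClass G i F → InClass G i FX
    class F-class e e∈FX = F-class e (inner⊆F {F} {F⁰} {X} e∈FX)

    edges-inside : ∀ e → e ∈ FX → EdgeIn G X e
    edges-inside e e∈FX = proj₂ (∈-restrict⁻ {F ─ F⁰} {X} e∈FX)

    acyclic : CCGAcyclic G W F → CCGAcyclic G X FX
    acyclic acyclicW C cycle = acyclicW C (map⁺ (λ D → D) edge cycle)
      where
      edge : ∀ {D D′} → CCGEdge G X FX D D′ → CCGEdge G W F D D′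
      edge (pD , pD′ , D≢D′ , e , e∈FX , s∈D , t∈D′) =
        component-from-part pD , component-from-part pD′ , D≢D′ ,
        e , inner⊆F {F} {F⁰} {X} e∈FX , s∈D , t∈D′

    count : ∀ {k a} (nc : NumComponents G W F k) →
            Enumeration (λ j → anchor (proj₁ (proj₂ nc) j) ∈ X) a → NumComponents G X FX a
    count nc@(f , fC , _) anchors = enumeration-cong to-part from-part
      (enumeration-sub {R = Meets} nc
        (enumeration-cong (λ {j} u∈X → anchor (fC j) , anchor∈ (fC j) , u∈X)
                          (λ {j} (v , v∈ , v∈X) → anchor-in (fC j) v∈ v∈X) anchors))
      where
      Meets : Subset n → Set
      Meets D = ∃ λ v → v ∈ D × v ∈ X
      to-part : ∀ {D} → IsComponent G W F D × Meets D → IsComponent G X FX D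
      to-part (pD , v , v∈D , v∈X) = component-to-part pD (anchor-in pD v∈D v∈X)
      from-part : ∀ {D} → IsComponent G X FX D → IsComponent G W F D × Meets D
      from-part pD = component-from-part pD , anchor pD , anchor∈ pD , component⊆ pD (anchor∈ pD)

    count-nonzero : Nonempty X → NumComponents G X FX 0 → Empty
    count-nonzero (x , x∈X) (_ , _ , _ , onto) with onto _ (component-isComponent {F = FX} x∈X)
    ... | () , _

    count-one : NumComponents G X FX 1 → IsComponent G W F X
    count-one (h , hC , _ , onto) = subst (IsComponent G W F) (sym X≡h0) (component-from-part (hC zero))
      where
      X≡h0 : X ≡ h zero
      X≡h0 = ⊆-antisym
        (λ {v} v∈X → let y , hy≡ = onto _ (component-isComponent {F = FX} v∈X)
                     in subst (v ∈_) (sym (trans (cong h (sym (single y))) hy≡)) (component-complete ε))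
        (component⊆ (hC zero))
        where
        single : (y : Fin 1) → y ≡ zero
        single zero = refl

    count-several : ∀ {a} → NumComponents G X FX (suc (suc a)) → ¬ IsComponent G W F X
    count-several (h , hC , h-injective , _) pX = 0≢1+n (h-injective (trans (is-X zero) (sym (is-X (suc zero)))))
      where
      pX′ : IsComponent G X FX X
      pX′ = component-to-part pX (anchor∈ pX)
      is-X : ∀ y → h y ≡ X
      is-X y = component-unique (hC y) pX′ (anchor∈ (hC y)) (component⊆ (hC y) (anchor∈ (hC y)))

  removed-nonempty : ∀ {W F k} → WeaklyConnected G W → NumComponents G W F (suc (suc k)) → Nonempty F
  removed-nonempty {W} {F} (_ , connected) (f , fC , f-injective , _) with nonempty? F
  ... | yes nonempty = nonempty
  ... | no empty =
    contradiction (f-injective (component-unique (fC zero) (fC (suc zero)) u₁∈f₀ (anchor∈ (fC (suc zero)))))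
                  0≢1+n
    where
    in-W : ∀ j → anchor (fC j) ∈ W
    in-W j = component⊆ (fC j) (anchor∈ (fC j))
    walk : Conn G W F (anchor (fC zero)) (anchor (fC (suc zero)))
    walk = Conn-extend ⊆-refl (λ e _ e∈F → contradiction (e , e∈F) empty)
                       (connected _ _ (in-W zero) (in-W (suc zero)))
    u₁∈f₀ : anchor (fC (suc zero)) ∈ f zero
    u₁∈f₀ = Conn-closed (component-closed (fC zero)) (anchor∈ (fC zero)) walk

  -- In the finite acyclic CCG pick a source
  -- component s (no F-edge enters it from outside) and a vertex t of another
  -- component; let T be the weak component of t in G[W ∖ s] and S = W ∖ T.
  -- Every edge between S and T then is an F-edge from s into T, so removing
  -- the set F⁰ of F-edges from S to T is a 2–PFD of G[W] into S , T.
  module Split {W F k} (connected : WeaklyConnected G W) (F-in-W : ∀ e → e ∈ F → EdgeIn G W e)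
               (nc : NumComponents G W F (suc (suc k))) (acyclic : CCGAcyclic G W F) where
    private
      f : Fin (suc (suc k)) → Subset n
      f = proj₁ nc
      fC : ∀ j → IsComponent G W F (f j)
      fC = proj₁ (proj₂ nc)
      f-injective : Injective _≡_ _≡_ f
      f-injective = proj₁ (proj₂ (proj₂ nc))
      f-onto : ∀ C → IsComponent G W F C → ∃ λ j → f j ≡ C
      f-onto = proj₂ (proj₂ (proj₂ nc))

      Entered : Fin (suc (suc k)) → Set
      Entered j = ∃ λ e → e ∈ F × tgt e ∈ f j × src e ∉ f j

      Entered? : ∀ j → Dec (Entered j)
      Entered? j = any? λ e → (e ∈? F) ×-dec (tgt e ∈? f j) ×-dec ¬? (src e ∈? f j)

      entered⇒predecessor : ∀ {j} → Entered j → ∃ λ j′ → CCGEdge G W F (f j′) (f j)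
      entered⇒predecessor {j} (e , e∈F , t∈ , s∉) =
        j′ , fC j′ , fC j , (λ eq → s∉ (subst (src e ∈_) eq s∈)) , e , e∈F , s∈ , t∈
        where
        j′ : Fin (suc (suc k))
        j′ = proj₁ (f-onto _ (component-isComponent {F = F} (proj₁ (F-in-W e e∈F))))
        s∈ : src e ∈ f j′
        s∈ = subst (src e ∈_) (sym (proj₂ (f-onto _ (component-isComponent (proj₁ (F-in-W e e∈F))))))
                   (component-complete ε)

      source : ∃ λ j → ¬ Entered j
      source = minimal (λ j′ j → CCGEdge G W F (f j′) (f j))
                       (λ j cycle → acyclic (f j) (map⁺ f (λ r → r) cycle))
                       Entered? entered⇒predecessor zero

    opaque
      s : Subset n
      s = f (proj₁ source)

      p-s : IsComponent G W F s
      p-s = fC (proj₁ source)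

      entering-s : ∀ {e} → e ∈ F → tgt e ∈ s → src e ∈ s
      entering-s {e} e∈F t∈s with src e ∈? s
      ... | yes s∈s = s∈s
      ... | no s∉s  = contradiction (e , e∈F , t∈s , s∉s) (proj₂ source)

      t : Fin n
      t = anchor (fC (punchIn (proj₁ source) zero))

      t∈W : t ∈ W
      t∈W = component⊆ (fC (punchIn (proj₁ source) zero)) (anchor∈ (fC (punchIn (proj₁ source) zero)))

      t∉s : t ∉ s
      t∉s t∈s = punchInᵢ≢i (proj₁ source) zero
        (f-injective (component-unique (fC _) p-s (anchor∈ (fC (punchIn (proj₁ source) zero))) t∈s))

    T : Subset n
    T = component (W ─ s) ⊥ t

    t∈T : t ∈ T
    t∈T = component-complete ε

    private
      p-T′ : IsComponent G (W ─ s) ⊥ T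
      p-T′ = component-isComponent (x∈p∧x∉q⇒x∈p─q t∈W t∉s)

    T⊆W : T ⊆ W
    T⊆W x∈T = p─q⊆p W s (component⊆ p-T′ x∈T)

    T-avoids-s : ∀ {x} → x ∈ T → x ∉ s
    T-avoids-s x∈T = x∈p─q⇒x∉q W s (component⊆ p-T′ x∈T)

    T-neighbour : ∀ {x y} → x ∈ T → Adj G W ⊥ x y → y ∈ T ⊎ y ∈ s
    T-neighbour {x} {y} x∈T adj with y ∈? s
    ... | yes y∈s = inj₂ y∈s
    ... | no y∉s  = inj₁ (component-closed p-T′ x∈T
                      (Adj-within ⊆-refl (component⊆ p-T′ x∈T)
                                  (x∈p∧x∉q⇒x∈p─q (Adj-target adj) y∉s) adj))

    -- an edge between T and s is an F-edge (s is a component for F) directed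
    -- into T (s is a source)
    private
      T-s-edge-in-F : ∀ {e} → EdgeIn G W e →
                      (src e ∈ T × tgt e ∈ s) ⊎ (src e ∈ s × tgt e ∈ T) → e ∈ F
      T-s-edge-in-F {e} e∈W ends with e ∈? F | ends
      ... | yes e∈F | _ = e∈F
      ... | no e∉F | inj₁ (s∈T , t∈s) =
        absurd (T-avoids-s s∈T (component-closed p-s t∈s (e , e∈W , e∉F , inj₂ (refl , refl))))
      ... | no e∉F | inj₂ (s∈s , t∈T) =
        absurd (T-avoids-s t∈T (component-closed p-s s∈s (e , e∈W , e∉F , inj₁ (refl , refl))))

    leaving-T : ∀ {e} → EdgeIn G W e → src e ∈ T → tgt e ∈ T
    leaving-T {e} e∈W s∈T with T-neighbour s∈T (e , e∈W , ∉⊥ , inj₁ (refl , refl))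
    ... | inj₁ t∈T = t∈T
    ... | inj₂ t∈s = absurd (T-avoids-s s∈T (entering-s (T-s-edge-in-F e∈W (inj₁ (s∈T , t∈s))) t∈s))

    entering-T : ∀ {e} → EdgeIn G W e → src e ∉ T → tgt e ∈ T → e ∈ F × src e ∈ s
    entering-T {e} e∈W s∉T t∈T with T-neighbour t∈T (e , e∈W , ∉⊥ , inj₂ (refl , refl))
    ... | inj₁ s∈T = contradiction s∈T s∉T
    ... | inj₂ s∈s = T-s-edge-in-F e∈W (inj₂ (s∈s , t∈T)) , s∈s

    S : Subset n
    S = W ─ T

    S⊆W : S ⊆ W
    S⊆W = p─q⊆p W T

    S-avoids-T : ∀ {x} → x ∈ S → x ∉ T
    S-avoids-T = x∈p─q⇒x∉q W T

    S⁺ : ∀ {x} → x ∈ W → x ∉ T → x ∈ S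
    S⁺ = x∈p∧x∉q⇒x∈p─q

    s⊆S : s ⊆ S
    s⊆S x∈s = S⁺ (component⊆ p-s x∈s) (λ x∈T → T-avoids-s x∈T x∈s)

    private
      crossing? : ∀ e → Dec (src e ∈ S × tgt e ∈ T)
      crossing? e = (src e ∈? S) ×-dec (tgt e ∈? T)

    F⁰ : Subset m
    F⁰ = ⟦ crossing? ⟧

    F⁰⁺ : ∀ {e} → src e ∈ S → tgt e ∈ T → e ∈ F⁰
    F⁰⁺ s∈S t∈T = ∈⟦⟧⁺ crossing? (s∈S , t∈T)

    F⁰⁻ : ∀ {e} → e ∈ F⁰ → src e ∈ S × tgt e ∈ T
    F⁰⁻ = ∈⟦⟧⁻ crossing?

    F⁰⊆F : F⁰ ⊆ F
    F⁰⊆F e∈F⁰ with F⁰⁻ e∈F⁰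
    ... | s∈S , t∈T = proj₁ (entering-T (S⊆W s∈S , T⊆W t∈T) (S-avoids-T s∈S) t∈T)

    private
      crossing⇒F⁰ : ∀ {e} → EdgeIn G W e → src e ∉ T → tgt e ∈ T → e ∈ F⁰
      crossing⇒F⁰ (s∈W , _) s∉T t∈T = F⁰⁺ (S⁺ s∈W s∉T) t∈T

    S-closed : AdjClosed W F⁰ S
    S-closed {a} {b} a∈S (e , e∈W , e∉F⁰ , ends) with b ∈? T | ends
    ... | no b∉T  | _                  = S⁺ (Adj-target (e , e∈W , e∉F⁰ , ends)) b∉T
    ... | yes b∈T | inj₁ (refl , refl) = contradiction (crossing⇒F⁰ e∈W (S-avoids-T a∈S) b∈T) e∉F⁰
    ... | yes b∈T | inj₂ (refl , refl) = contradiction (leaving-T e∈W b∈T) (S-avoids-T a∈S)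

    T-closed : AdjClosed W F⁰ T
    T-closed {a} {b} a∈T (e , e∈W , e∉F⁰ , inj₁ (refl , refl)) = leaving-T e∈W a∈T
    T-closed {a} {b} a∈T (e , e∈W , e∉F⁰ , inj₂ (refl , refl)) with b ∈? T
    ... | yes b∈T = b∈T
    ... | no b∉T  = contradiction (crossing⇒F⁰ e∈W b∉T a∈T) e∉F⁰

    no-F⁰-in-S : ∀ e → EdgeIn G S e → e ∉ F⁰
    no-F⁰-in-S e (_ , t∈S) e∈F⁰ = S-avoids-T t∈S (proj₂ (F⁰⁻ e∈F⁰))

    no-F⁰-in-T : ∀ e → EdgeIn G T e → e ∉ F⁰
    no-F⁰-in-T e (s∈T , _) e∈F⁰ = S-avoids-T (proj₁ (F⁰⁻ e∈F⁰)) s∈T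

    private
      T-reaches : ∀ {v} → v ∈ T → Conn G T ⊥ t v
      T-reaches v∈T = Conn-restrict (component-closed p-T′) ⊥⊆ t∈T (component-sound v∈T)

    T-connected : WeaklyConnected G T
    T-connected = (t , t∈T) , λ u v u∈T v∈T → Conn-sym (T-reaches u∈T) ◅◅ T-reaches v∈T

    -- S is weakly connected: a walk of G[W] from a vertex of S to s cannot
    -- enter T before reaching s, and s itself is connected
    private
      s₀ : Fin n
      s₀ = anchor p-s

      s₀∈S : s₀ ∈ S
      s₀∈S = s⊆S (anchor∈ p-s)

      walk-to-s : ∀ {v x} → v ∈ S → Conn G W ⊥ v x → x ∈ s → ∃ λ y → y ∈ s × Conn G S ⊥ v y
      walk-to-s {v} v∈S walk x∈s with v ∈? s
      ... | yes v∈s = v , v∈s , ε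
      walk-to-s v∈S ε x∈s | no v∉s = contradiction x∈s v∉s
      walk-to-s {v} v∈S (_◅_ {j = w} adj walk) x∈s | no v∉s =
        let y , y∈s , rest = walk-to-s w∈S walk x∈s
        in  y , y∈s , Adj-within ⊆-refl v∈S w∈S adj ◅ rest
        where
        w∈S : w ∈ S
        w∈S = S⁺ (Adj-target adj) λ w∈T → case-T (T-neighbour w∈T (Adj-sym adj))
          where
          case-T : v ∈ T ⊎ v ∈ s → Empty
          case-T (inj₁ v∈T) = S-avoids-T v∈S v∈T
          case-T (inj₂ v∈s) = v∉s v∈s

      S-reaches : ∀ {v} → v ∈ S → Conn G S ⊥ v s₀
      S-reaches v∈S
        with walk-to-s v∈S (proj₂ connected _ s₀ (S⊆W v∈S) (component⊆ p-s (anchor∈ p-s))) (anchor∈ p-s)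
      ... | y , y∈s , walk =
        walk ◅◅ Conn-restrict (AdjClosed-mono F⁰⊆F S-closed) ⊥⊆ (s⊆S y∈s)
                              (component-connected p-s y∈s (anchor∈ p-s))

    S-connected : WeaklyConnected G S
    S-connected = (s₀ , s₀∈S) , λ u v u∈S v∈S → S-reaches u∈S ◅◅ Conn-sym (S-reaches v∈S)

    private
      p-S : IsComponent G W F⁰ S
      p-S = closed-part-is-component S⊆W S-closed s₀∈S λ v∈S →
              Conn-extend S⊆W (λ e e∈S e∈F⁰ → contradiction e∈F⁰ (no-F⁰-in-S e e∈S))
                          (Conn-sym (S-reaches v∈S))

      p-T : IsComponent G W F⁰ T
      p-T = closed-part-is-component T⊆W T-closed t∈T λ v∈T →
              Conn-extend T⊆W (λ e e∈T e∈F⁰ → contradiction e∈F⁰ (no-F⁰-in-T e e∈T))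
                          (T-reaches v∈T)

      S≢T : S ≢ T
      S≢T S≡T = S-avoids-T s₀∈S (subst (s₀ ∈_) S≡T s₀∈S)

      only-S-T : ∀ C → IsComponent G W F⁰ C → C ≡ S ⊎ C ≡ T
      only-S-T C pC with anchor pC ∈? T
      ... | yes c∈T = inj₂ (component-unique pC p-T (anchor∈ pC) c∈T)
      ... | no c∉T  = inj₁ (component-unique pC p-S (anchor∈ pC)
                              (S⁺ (component⊆ pC (anchor∈ pC)) c∉T))

      crossing-edge : ∀ {v x} → v ∉ T → Conn G W ⊥ v x → x ∈ T →
                      ∃ λ e → EdgeIn G W e × src e ∉ T × tgt e ∈ T
      crossing-edge v∉T ε x∈T = contradiction x∈T v∉T
      crossing-edge v∉T (_◅_ {j = w} (e , e∈W , _ , ends) walk) x∈T with w ∈? T | ends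
      ... | no w∉T  | _                  = crossing-edge w∉T walk x∈T
      ... | yes w∈T | inj₁ (refl , refl) = e , e∈W , v∉T , w∈T
      ... | yes w∈T | inj₂ (refl , refl) = contradiction (leaving-T e∈W w∈T) v∉T

      S→T : CCGEdge G W F⁰ S T
      S→T with crossing-edge (S-avoids-T s₀∈S) (proj₂ connected s₀ t (S⊆W s₀∈S) t∈W) t∈T
      ... | e , e∈W , s∉T , t∈T′ =
        p-S , p-T , S≢T , e , crossing⇒F⁰ e∈W s∉T t∈T′ , S⁺ (proj₁ e∈W) s∉T , t∈T′

      no-T→S : ¬ CCGEdge G W F⁰ T S
      no-T→S (_ , _ , _ , e , e∈F⁰ , s∈T , _) = S-avoids-T (proj₁ (F⁰⁻ e∈F⁰)) s∈T

    two-pfd : TwoPFD G W F⁰ S T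
    two-pfd = p-S , p-T , S≢T , only-S-T , inj₁ (S→T , no-T→S)

    module S-part = SubProblem {W} {F} {F⁰} {S} F⁰⊆F S⊆W S-closed no-F⁰-in-S
    module T-part = SubProblem {W} {F} {F⁰} {T} F⁰⊆F T⊆W T-closed no-F⁰-in-T

    private
      by-part : Partition (λ j → anchor (fC j) ∈ T)
      by-part = partition (λ j → anchor (fC j) ∈ T) (λ j → anchor (fC j) ∈? T)
      open Partition by-part using (size⁺; size⁻; enum⁺; enum⁻)

    size-S size-T : ℕ
    size-S = size⁻
    size-T = size⁺

    size-S+size-T : size-S + size-T ≡ suc (suc k)
    size-S+size-T = trans (ℕP.+-comm size⁻ size⁺) (Partition.sizes by-part)

    count-S : NumComponents G S (inner F F⁰ S) size-S
    count-S = S-part.count nc (enumeration-cong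
      (λ {j} u∉T → S⁺ (component⊆ (fC j) (anchor∈ (fC j))) u∉T) S-avoids-T enum⁻)

    count-T : NumComponents G T (inner F F⁰ T) size-T
    count-T = T-part.count nc enum⁺

  private
    smaller : ∀ {a b K N} → suc a + b ≡ K → K ≤ suc N → b ≤ N
    smaller {a} refl (s≤s a+b≤N) = ℕP.m+n≤o⇒n≤o a a+b≤N

  acyclic⇒pfd : ∀ N {W F k} → k ≤ N → WeaklyConnected G W → InClass G i F →
                (∀ e → e ∈ F → EdgeIn G W e) → 2 ≤ k → NumComponents G W F k → CCGAcyclic G W F →
                PFD G i W F k
  acyclic⇒pfd zero    () _ _ _ (s≤s (s≤s _)) _ _
  acyclic⇒pfd (suc N) {W} {F} {suc (suc k)} k≤N connected class F-in-W 2≤k@(s≤s (s≤s _)) nc acyclic =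
    pfd connected class (removed-nonempty connected nc) F-in-W 2≤k nc F⁰ F⁰⊆F S T two-pfd
        (cases size-S size-T size-S+size-T count-S count-T)
    where
    open Split connected F-in-W nc acyclic

    sub-S : ∀ {a} → suc (suc a) ≤ N → NumComponents G S (inner F F⁰ S) (suc (suc a)) →
            PFD G i S (inner F F⁰ S) (suc (suc a))
    sub-S a≤N ncS = acyclic⇒pfd N a≤N S-connected (S-part.class class) S-part.edges-inside
                                (s≤s (s≤s z≤n)) ncS (S-part.acyclic acyclic)

    sub-T : ∀ {b} → suc (suc b) ≤ N → NumComponents G T (inner F F⁰ T) (suc (suc b)) →
            PFD G i T (inner F F⁰ T) (suc (suc b))
    sub-T b≤N ncT = acyclic⇒pfd N b≤N T-connected (T-part.class class) T-part.edges-inside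
                                (s≤s (s≤s z≤n)) ncT (T-part.acyclic acyclic)

    cases : ∀ a b → a + b ≡ suc (suc k) →
            NumComponents G S (inner F F⁰ S) a → NumComponents G T (inner F F⁰ T) b →
            ((IsComponent G W F S × IsComponent G W F T)
            ⊎ (IsComponent G W F S × PFD G i T (inner F F⁰ T) (suc k))
            ⊎ (IsComponent G W F T × PFD G i S (inner F F⁰ S) (suc k))
            ⊎ (¬ IsComponent G W F S × ¬ IsComponent G W F T ×
               Σ ℕ λ k₁ → Σ ℕ λ k₂ → k₁ + k₂ ≡ suc (suc k) ×
                 PFD G i S (inner F F⁰ S) k₁ × PFD G i T (inner F F⁰ T) k₂))
    cases zero _ _ ncS _ = absurd (S-part.count-nonzero (proj₁ S-connected) ncS)
    cases (suc a) zero _ _ ncT = absurd (T-part.count-nonzero (proj₁ T-connected) ncT)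
    cases 1 1 _ ncS ncT = inj₁ (S-part.count-one ncS , T-part.count-one ncT)
    cases 1 (suc (suc b)) sum ncS ncT =
      inj₂ (inj₁ (S-part.count-one ncS ,
                  subst (PFD G i T _) (ℕP.suc-injective sum) (sub-T (smaller {a = 0} sum k≤N) ncT)))
    cases (suc (suc a)) 1 sum ncS ncT =
      inj₂ (inj₂ (inj₁ (T-part.count-one ncT ,
                        subst (PFD G i S _) (ℕP.suc-injective sum′) (sub-S (smaller {a = 0} sum′ k≤N) ncS))))
      where
      sum′ : 1 + suc (suc a) ≡ suc (suc k)
      sum′ = trans (ℕP.+-comm 1 (suc (suc a))) sum
    cases (suc (suc a)) (suc (suc b)) sum ncS ncT =
      inj₂ (inj₂ (inj₂ (S-part.count-several ncS , T-part.count-several ncT , _ , _ , sum ,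
        sub-S (smaller {a = suc b} (trans (ℕP.+-comm (suc (suc b)) (suc (suc a))) sum) k≤N) ncS ,
        sub-T (smaller {a = suc a} sum k≤N) ncT)))

-- The theorem is the case W = V: both directions above, every edge lying in G[V].
theorem3 : (G : Graph) → (i : Fin (Graph.p G)) → (Ē : Subset (Graph.m G)) →
           WeaklyConnected G ⊤ → InClass G i Ē → Nonempty Ē →
           (k : ℕ) → 2 ≤ k → NumComponents G ⊤ Ē k →
           (PFD G i ⊤ Ē k ⇔ CCGAcyclic G ⊤ Ē)
theorem3 G i Ē connected class _ k 2≤k nc =
  mk⇔ (PFD⇒Acyclic.pfd⇒acyclic G)
      (Acyclic⇒PFD.acyclic⇒pfd G i k ℕP.≤-refl connected class (λ _ _ → ∈⊤ , ∈⊤) 2≤k nc)
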